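{- For positive integers $k,l$, \[ n(k,l)\le \binom{k+l}{l+1}+\binom{k+l}{k+1}, \] where $n(k,l)$ is the maximum of $\left|\bigcup_{i=1}^m(A_i\cup B_i)\right|$ over all $(k,l)$-cross intersecting systems $(A_1,B_1),\dots,(A_m,B_m)$.
   Context: A system of set pairs $(A_1,B_1),\dots,(A_m,B_m)$ is $(k,l)$-cross intersecting if $|A_i|\le k$ and $|B_i|\le l$ for all $i$, $A_i\cap B_i=\emptyset$ for all $i$, and $A_i\cap B_j\neq\emptyset$ for all $i\neq j$. -}

module Defs where

open import Data.Nat using (ℕ; _≤_)
open import Data.Fin using (Fin)
open import Data.Fin.Subset using (Subset; _∩_; _∪_; ⋃; ∣_∣; Empty; Nonempty)
open import Data.List using (map; allFin)
open import Data.Product using (_×_)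
open import Relation.Binary.PropositionalEquality using (_≢_)

-- A system of m set pairs (A_i, B_i), i ∈ Fin m, over a finite ground set Fin N
-- (any finite family of finite sets can be relabelled into some Fin N).
record CrossIntersecting (k l N m : ℕ) (A B : Fin m → Subset N) : Set where
  field
    sizeA    : ∀ i → ∣ A i ∣ ≤ k
    sizeB    : ∀ i → ∣ B i ∣ ≤ l
    disjoint : ∀ i → Empty (A i ∩ B i)
    cross    : ∀ i j → i ≢ j → Nonempty (A i ∩ B j)

unionAll : ∀ {N m} → (Fin m → Subset N) → (Fin m → Subset N) → Subset N
unionAll {m = m} A B = ⋃ (map (λ i → A i ∪ B i) (allFin m))

module Submission where

-- Let ι x be the index of the first pair (A i , B i) containing the point x.  The union
-- splits into the points x with x ∈ A (ι x) and those with x ∈ B (ι x).  For the former,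
-- the pairs (A (ι x) − x , {x} ∪ B (ι x)) form a skew cross-intersecting family ranked
-- by ι: sizes at most k − 1 and l + 1, disjoint within a pair, and P y ∩ R z ≠ ∅ whenever
-- y ≠ z and ι z ≤ ι y.  The skew Bollobás theorem bounds such a family by C(k+l, l+1);
-- exchanging the roles of the A's and B's bounds the latter points by C(k+l, k+1).
--
-- The skew Bollobás theorem is proved by the polynomial method over ℤ: y gets the form
-- ∏_{t ∈ P y} (Σᵢ tⁱ uᵢ) of degree k − 1 in l + 2 variables, z gets the coefficient
-- vector of ∏_{s ∈ R z} (X − s).  The evaluation matrix is triangular with nonzero diagonal,
-- so these forms are linearly independent, and there are at most as many as the dimension
-- C(k+l, l+1) of the space of forms.

module SubsetFacts where

  open import Data.Nat using (zero; suc; _+_; _≤_; _<_; z≤n; s≤s)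
  open import Data.Nat.Properties using (≤-trans; ≤-reflexive; +-suc; +-monoʳ-≤; n≤1+n; <⇒≢)
  open import Data.Fin using (Fin; zero; suc)
  open import Data.Fin.Properties using (_≟_)
  open import Data.Vec.Base using ([]; _∷_; here; there)
  open import Data.Fin.Subset
  open import Data.Fin.Subset.Properties
  open import Data.Sum using (inj₁; inj₂)
  open import Data.Empty using (⊥-elim)
  open import Function using (_∘_)
  open import Relation.Binary.PropositionalEquality using (_≢_; refl; sym; trans; cong)
  open import Relation.Nullary using (Dec; yes; no)

  ∣p∪q∣≤∣p∣+∣q∣ : ∀ {n} (p q : Subset n) → ∣ p ∪ q ∣ ≤ ∣ p ∣ + ∣ q ∣
  ∣p∪q∣≤∣p∣+∣q∣ []            []            = z≤n
  ∣p∪q∣≤∣p∣+∣q∣ (inside  ∷ p) (inside  ∷ q) = s≤s (≤-trans (∣p∪q∣≤∣p∣+∣q∣ p q) (+-monoʳ-≤ ∣ p ∣ (n≤1+n ∣ q ∣)))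
  ∣p∪q∣≤∣p∣+∣q∣ (inside  ∷ p) (outside ∷ q) = s≤s (∣p∪q∣≤∣p∣+∣q∣ p q)
  ∣p∪q∣≤∣p∣+∣q∣ (outside ∷ p) (inside  ∷ q) = ≤-trans (s≤s (∣p∪q∣≤∣p∣+∣q∣ p q)) (≤-reflexive (sym (+-suc ∣ p ∣ ∣ q ∣)))
  ∣p∪q∣≤∣p∣+∣q∣ (outside ∷ p) (outside ∷ q) = ∣p∪q∣≤∣p∣+∣q∣ p q

  ∣⁅x⁆∪p∣≤1+∣p∣ : ∀ {n} (x : Fin n) (p : Subset n) → ∣ ⁅ x ⁆ ∪ p ∣ ≤ suc ∣ p ∣
  ∣⁅x⁆∪p∣≤1+∣p∣ x p = ≤-trans (∣p∪q∣≤∣p∣+∣q∣ ⁅ x ⁆ p) (≤-reflexive (cong (_+ ∣ p ∣) (∣⁅x⁆∣≡1 x)))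

  x∉p-x : ∀ {n} (p : Subset n) (x : Fin n) → x ∉ p - x
  x∉p-x (s ∷ p) zero    ()
  x∉p-x (s ∷ p) (suc x) (there x∈p-x) = x∉p-x p x x∈p-x

  x∈p-y⇒x≢y : ∀ {n} {p : Subset n} {x y : Fin n} → x ∈ p - y → x ≢ y
  x∈p-y⇒x≢y {p = p} {x} x∈p-x refl = x∉p-x p x x∈p-x

  ∣p∣≤1+∣p-x∣ : ∀ {n} (p : Subset n) (x : Fin n) → ∣ p ∣ ≤ suc ∣ p - x ∣
  ∣p∣≤1+∣p-x∣ p x = ≤-trans (p⊆q⇒∣p∣≤∣q∣ p⊆⁅x⁆∪p-x) (∣⁅x⁆∪p∣≤1+∣p∣ x (p - x))
    where
    p⊆⁅x⁆∪p-x : p ⊆ ⁅ x ⁆ ∪ (p - x)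
    p⊆⁅x⁆∪p-x {y} y∈p with y ≟ x
    ... | yes refl = x∈p∪q⁺ (inj₁ (x∈⁅x⁆ x))
    ... | no  y≢x  = x∈p∪q⁺ (inj₂ (x∈p∧x≢y⇒x∈p-y y∈p y≢x))

  0<∣p∣⇒Nonempty : ∀ {n} (p : Subset n) → 0 < ∣ p ∣ → Nonempty p
  0<∣p∣⇒Nonempty {n} p 0<∣p∣ with nonempty? p
  ... | yes p≢∅ = p≢∅
  ... | no  p≡∅ = ⊥-elim (<⇒≢ 0<∣p∣ (sym (trans (cong ∣_∣ (Empty-unique p≡∅)) (∣⊥∣≡0 n))))

  select : ∀ {n} {Q : Fin n → Set} → (∀ x → Dec (Q x)) → Subset n
  select {zero}  Q? = []
  select {suc n} Q? with Q? zero
  ... | yes _ = inside  ∷ select (Q? ∘ suc)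
  ... | no  _ = outside ∷ select (Q? ∘ suc)

  select⁺ : ∀ {n} {Q : Fin n → Set} (Q? : ∀ x → Dec (Q x)) {x} → Q x → x ∈ select Q?
  select⁺ {suc n} Q? {x} q with Q? zero
  select⁺ {suc n} Q? {zero}  q | yes _  = here
  select⁺ {suc n} Q? {zero}  q | no ¬q  = ⊥-elim (¬q q)
  select⁺ {suc n} Q? {suc x} q | yes _  = there (select⁺ (Q? ∘ suc) q)
  select⁺ {suc n} Q? {suc x} q | no  _  = there (select⁺ (Q? ∘ suc) q)

  select⁻ : ∀ {n} {Q : Fin n → Set} (Q? : ∀ x → Dec (Q x)) {x} → x ∈ select Q? → Q x
  select⁻ {suc n} Q? {x} x∈ with Q? zero
  select⁻ {suc n} Q? {zero}  here       | yes q = q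
  select⁻ {suc n} Q? {suc x} (there x∈) | yes _ = select⁻ (Q? ∘ suc) x∈
  select⁻ {suc n} Q? {suc x} (there x∈) | no  _ = select⁻ (Q? ∘ suc) x∈

module IntegerVectors where

  open import Data.Integer using (ℤ; 0ℤ; 1ℤ; _+_; _*_)
  open import Data.Integer.Properties
    using (+-identityˡ; +-assoc; *-zeroʳ; *-assoc; *-distribˡ-+; *-distribʳ-+; i*j≡0⇒i≡0∨j≡0)
  open import Data.Integer.Tactic.RingSolver using (solve-∀)
  open import Data.Vec using (Vec; []; _∷_; _++_; map; replicate; zipWith)
  open import Data.Vec.Relation.Unary.Any using (Any; here; there)
  open import Data.Vec.Relation.Unary.All using (All; []; _∷_)
  open import Data.Sum using (inj₁; inj₂)
  open import Relation.Binary.PropositionalEquality using (_≡_; _≢_; refl; sym; trans; cong; cong₂)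

  dot : ∀ {n} → Vec ℤ n → Vec ℤ n → ℤ
  dot []       []       = 0ℤ
  dot (a ∷ as) (b ∷ bs) = a * b + dot as bs

  dot-++ : ∀ {m n} (a : Vec ℤ m) (b : Vec ℤ n) c d → dot (a ++ b) (c ++ d) ≡ dot a c + dot b d
  dot-++ []      b []      d = sym (+-identityˡ _)
  dot-++ (x ∷ a) b (y ∷ c) d = trans (cong (x * y +_) (dot-++ a b c d)) (sym (+-assoc (x * y) _ _))

  dot-scaleˡ : ∀ {n} (t : ℤ) (v w : Vec ℤ n) → dot (map (t *_) v) w ≡ t * dot v w
  dot-scaleˡ t []      []      = sym (*-zeroʳ t)
  dot-scaleˡ t (a ∷ v) (b ∷ w) = trans (cong₂ _+_ (*-assoc t a b) (dot-scaleˡ t v w)) (sym (*-distribˡ-+ t (a * b) _))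

  dot-scaleʳ : ∀ {n} (t : ℤ) (v w : Vec ℤ n) → dot v (map (t *_) w) ≡ t * dot v w
  dot-scaleʳ t []      []      = sym (*-zeroʳ t)
  dot-scaleʳ t (a ∷ v) (b ∷ w) = trans (cong₂ _+_ (swap-scalar a b t) (dot-scaleʳ t v w)) (sym (*-distribˡ-+ t (a * b) _))
    where
    swap-scalar : ∀ a b t → a * (t * b) ≡ t * (a * b)
    swap-scalar = solve-∀

  dot-addˡ : ∀ {n} (u v w : Vec ℤ n) → dot (zipWith _+_ u v) w ≡ dot u w + dot v w
  dot-addˡ []      []      []      = refl
  dot-addˡ (a ∷ u) (b ∷ v) (c ∷ w) = trans (cong₂ _+_ (*-distribʳ-+ c a b) (dot-addˡ u v w)) (interchange (a * c) (b * c) _ _)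
    where
    interchange : ∀ a b c d → (a + b) + (c + d) ≡ (a + c) + (b + d)
    interchange = solve-∀

  dot-addʳ : ∀ {n} (u v w : Vec ℤ n) → dot u (zipWith _+_ v w) ≡ dot u v + dot u w
  dot-addʳ []      []      []      = refl
  dot-addʳ (a ∷ u) (b ∷ v) (c ∷ w) = trans (cong₂ _+_ (*-distribˡ-+ a b c) (dot-addʳ u v w)) (interchange (a * b) (a * c) _ _)
    where
    interchange : ∀ a b c d → (a + b) + (c + d) ≡ (a + c) + (b + d)
    interchange = solve-∀

  dot-zeroˡ : ∀ {n} (w : Vec ℤ n) → dot (replicate n 0ℤ) w ≡ 0ℤ
  dot-zeroˡ []      = refl
  dot-zeroˡ (b ∷ w) = trans (+-identityˡ _) (dot-zeroˡ w)

  product : ∀ {n} → Vec ℤ n → ℤ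
  product []       = 1ℤ
  product (a ∷ as) = a * product as

  product-zero : ∀ {n} {v : Vec ℤ n} → Any (_≡ 0ℤ) v → product v ≡ 0ℤ
  product-zero {v = a ∷ v} (here a≡0)  = cong (_* product v) a≡0
  product-zero {v = a ∷ v} (there any) = trans (cong (a *_) (product-zero any)) (*-zeroʳ a)

  product-nonzero : ∀ {n} {v : Vec ℤ n} → All (_≢ 0ℤ) v → product v ≢ 0ℤ
  product-nonzero []           ()
  product-nonzero {v = a ∷ v} (a≢0 ∷ all) av≡0 with i*j≡0⇒i≡0∨j≡0 a av≡0
  ... | inj₁ a≡0 = a≢0 a≡0
  ... | inj₂ v≡0 = product-nonzero all v≡0

module Polynomials where

  open import Data.Nat as ℕ using (ℕ; zero; suc)
  open import Data.Integer using (ℤ; 0ℤ; 1ℤ; _+_; _*_; -_; _-_)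
  open import Data.Integer.Properties using (*-identityʳ)
  open import Data.Integer.Tactic.RingSolver using (solve-∀)
  open import Data.Vec using (Vec; []; _∷_; _++_; map; replicate; zipWith; take; drop; _∷ʳ_)
  open import Data.Vec.Properties using (take++drop≡id)
  open import Relation.Binary.PropositionalEquality using (_≡_; refl; sym; trans; cong; cong₂; module ≡-Reasoning)
  open IntegerVectors

  -- dim d n is the number of monomials of degree d in n variables: such a
  -- monomial either contains the first variable or is one in the remaining ones.
  dim : ℕ → ℕ → ℕ
  dim zero    n       = 1
  dim (suc d) zero    = 0
  dim (suc d) (suc n) = dim d (suc n) ℕ.+ dim (suc d) n

  -- A homogeneous polynomial of degree d in n variables, given by its coefficients.
  Poly : ℕ → ℕ → Set
  Poly d n = Vec ℤ (dim d n)

  -- The values of all monomials of degree d at a point, in the order used by dim.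
  monomials : ∀ d {n} → Vec ℤ n → Poly d n
  monomials zero    u         = 1ℤ ∷ []
  monomials (suc d) []        = []
  monomials (suc d) (u₀ ∷ us) = map (u₀ *_) (monomials d (u₀ ∷ us)) ++ monomials (suc d) us

  eval : ∀ d {n} → Poly d n → Vec ℤ n → ℤ
  eval d p u = dot p (monomials d u)

  -- The coefficient vector of a polynomial of positive degree splits as p₁ ++ p₂,
  -- where p = u₀ · p₁ + p₂ and p₂ does not involve u₀.
  eval-split : ∀ {d n} (p₁ : Poly d (suc n)) (p₂ : Poly (suc d) n) u₀ us →
    eval (suc d) (p₁ ++ p₂) (u₀ ∷ us) ≡ u₀ * eval d p₁ (u₀ ∷ us) + eval (suc d) p₂ us
  eval-split {d} p₁ p₂ u₀ us = trans (dot-++ p₁ p₂ _ _) (cong (_+ eval (suc d) p₂ us) (dot-scaleʳ u₀ p₁ _))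

  weaken : ∀ {d n} → Poly (suc d) n → Poly (suc d) (suc n)
  weaken {d} {n} p = replicate (dim d (suc n)) 0ℤ ++ p

  eval-weaken : ∀ {d n} (p : Poly (suc d) n) u₀ us → eval (suc d) (weaken {d} {n} p) (u₀ ∷ us) ≡ eval (suc d) p us
  eval-weaken {d} {n} p u₀ us =
    trans (eval-split {d} {n} (replicate (dim d (suc n)) 0ℤ) p u₀ us)
          (trans (cong (λ z → u₀ * z + eval (suc d) p us) (dot-zeroˡ (monomials d (u₀ ∷ us)))) (u₀*0+a≡a u₀ _))
    where
    u₀*0+a≡a : ∀ u₀ a → u₀ * 0ℤ + a ≡ a
    u₀*0+a≡a = solve-∀

  linear : ∀ {n} → Vec ℤ n → Poly 1 n
  linear []       = []
  linear (a ∷ as) = a ∷ linear as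

  eval-linear : ∀ {n} (L u : Vec ℤ n) → eval 1 (linear L) u ≡ dot L u
  eval-linear []       []       = refl
  eval-linear (a ∷ as) (u ∷ us) = cong₂ _+_ (cong (a *_) (*-identityʳ u)) (eval-linear as us)

  -- Multiplication of a polynomial by the linear form ⟨L , ·⟩: writing L = l₀ ∷ ls
  -- and p = u₀ p₁ + p₂, the product is u₀ (L p₁ + l₀ p₂) + ⟨ls , ·⟩ p₂.
  mulLinear : ∀ {d n} → Vec ℤ n → Poly d n → Poly (suc d) n
  mulLinear {zero}          L         (c ∷ []) = linear (map (c *_) L)
  mulLinear {suc d} {zero}  []        p        = []
  mulLinear {suc d} {suc n} (l₀ ∷ ls) p        =
    zipWith _+_ (mulLinear (l₀ ∷ ls) p₁) (map (l₀ *_) (weaken {d} {n} p₂)) ++ mulLinear ls p₂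
    where
    p₁ : Poly d (suc n)
    p₁ = take (dim d (suc n)) p
    p₂ : Poly (suc d) n
    p₂ = drop (dim d (suc n)) p

  eval-mulLinear : ∀ {d n} (L : Vec ℤ n) (p : Poly d n) u → eval (suc d) (mulLinear L p) u ≡ dot L u * eval d p u
  eval-mulLinear {zero} L (c ∷ []) u =
    trans (eval-linear (map (c *_) L) u) (trans (dot-scaleˡ c L u) (reorder c (dot L u)))
    where
    reorder : ∀ c x → c * x ≡ x * (c * 1ℤ + 0ℤ)
    reorder = solve-∀
  eval-mulLinear {suc d} {zero}  []        p []        = refl
  eval-mulLinear {suc d} {suc n} (l₀ ∷ ls) p (u₀ ∷ us) = begin
      eval (suc (suc d)) (q₁ ++ mulLinear ls p₂) u
    ≡⟨ eval-split {suc d} q₁ (mulLinear ls p₂) u₀ us ⟩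
      u₀ * eval (suc d) q₁ u + eval (suc (suc d)) (mulLinear ls p₂) us
    ≡⟨ cong₂ (λ a b → u₀ * a + b) eval-q₁ (eval-mulLinear {suc d} ls p₂ us) ⟩
      u₀ * (ℓ * eval d p₁ u + l₀ * eval (suc d) p₂ us) + dot ls us * eval (suc d) p₂ us
    ≡⟨ regroup u₀ l₀ (dot ls us) (eval d p₁ u) (eval (suc d) p₂ us) ⟩
      ℓ * (u₀ * eval d p₁ u + eval (suc d) p₂ us)
    ≡⟨ cong (ℓ *_) (sym (eval-split {d} p₁ p₂ u₀ us)) ⟩
      ℓ * eval (suc d) (p₁ ++ p₂) u
    ≡⟨ cong (λ q → ℓ * eval (suc d) q u) (take++drop≡id (dim d (suc n)) p) ⟩
      ℓ * eval (suc d) p u ∎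
    where
    open ≡-Reasoning
    L = l₀ ∷ ls
    u = u₀ ∷ us
    ℓ = dot L u
    p₁ : Poly d (suc n)
    p₁ = take (dim d (suc n)) p
    p₂ : Poly (suc d) n
    p₂ = drop (dim d (suc n)) p
    q₁ : Poly (suc d) (suc n)
    q₁ = zipWith _+_ (mulLinear {d} L p₁) (map (l₀ *_) (weaken {d} {n} p₂))
    eval-q₁ : eval (suc d) q₁ u ≡ ℓ * eval d p₁ u + l₀ * eval (suc d) p₂ us
    eval-q₁ = trans (dot-addˡ (mulLinear {d} L p₁) _ _)
                    (cong₂ _+_ (eval-mulLinear {d} L p₁ u)
                               (trans (dot-scaleˡ l₀ (weaken {d} {n} p₂) _) (cong (l₀ *_) (eval-weaken {d} {n} p₂ u₀ us))))
    regroup : ∀ u₀ l₀ s e₁ e₂ → u₀ * ((l₀ * u₀ + s) * e₁ + l₀ * e₂) + s * e₂ ≡ (l₀ * u₀ + s) * (u₀ * e₁ + e₂)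
    regroup = solve-∀

  productOfLinear : ∀ {d n} → Vec (Vec ℤ n) d → Poly d n
  productOfLinear []       = 1ℤ ∷ []
  productOfLinear (L ∷ Ls) = mulLinear L (productOfLinear Ls)

  eval-productOfLinear : ∀ {d n} (Ls : Vec (Vec ℤ n) d) u → eval d (productOfLinear Ls) u ≡ product (map (λ L → dot L u) Ls)
  eval-productOfLinear []       u = refl
  eval-productOfLinear {suc d} (L ∷ Ls) u =
    trans (eval-mulLinear {d} L (productOfLinear Ls) u) (cong (dot L u *_) (eval-productOfLinear Ls u))

  -- powers t n = (1, t, …, tⁿ⁻¹); pairing it with a coefficient vector evaluates
  -- the corresponding univariate polynomial at t.
  powers : ℤ → (n : ℕ) → Vec ℤ n
  powers t zero    = []
  powers t (suc n) = 1ℤ ∷ map (t *_) (powers t n)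

  -- Coefficients, constant term first, of the monic polynomial ∏ (X - ρ) over ρ ∈ ρs;
  -- multiplying c by X - ρ shifts c up one degree and subtracts ρ c.
  rootPoly : ∀ {e} → Vec ℤ e → Vec ℤ (suc e)
  rootPoly []       = 1ℤ ∷ []
  rootPoly (ρ ∷ ρs) = zipWith _+_ (0ℤ ∷ rootPoly ρs) (map ((- ρ) *_) (rootPoly ρs) ∷ʳ 0ℤ)

  dot-powers-∷ʳ0 : ∀ t {k} (c : Vec ℤ k) → dot (powers t (suc k)) (c ∷ʳ 0ℤ) ≡ dot (powers t k) c
  dot-powers-∷ʳ0 t []       = refl
  dot-powers-∷ʳ0 t (c₀ ∷ cs) = cong (1ℤ * c₀ +_) (begin
      dot (map (t *_) (powers t _)) (cs ∷ʳ 0ℤ) ≡⟨ dot-scaleˡ t (powers t _) (cs ∷ʳ 0ℤ) ⟩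
      t * dot (powers t _) (cs ∷ʳ 0ℤ)         ≡⟨ cong (t *_) (dot-powers-∷ʳ0 t cs) ⟩
      t * dot (powers t _) cs                 ≡⟨ sym (dot-scaleˡ t (powers t _) cs) ⟩
      dot (map (t *_) (powers t _)) cs        ∎)
    where open ≡-Reasoning

  eval-rootPoly : ∀ t {e} (ρs : Vec ℤ e) → dot (powers t (suc e)) (rootPoly ρs) ≡ product (map (λ s → t - s) ρs)
  eval-rootPoly t []       = refl
  eval-rootPoly t {suc e} (ρ ∷ ρs) = begin
      dot T (zipWith _+_ (0ℤ ∷ c) (map ((- ρ) *_) c ∷ʳ 0ℤ))
    ≡⟨ dot-addʳ T (0ℤ ∷ c) (map ((- ρ) *_) c ∷ʳ 0ℤ) ⟩
      1ℤ * 0ℤ + dot (map (t *_) (powers t (suc e))) c + dot T (map ((- ρ) *_) c ∷ʳ 0ℤ)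
    ≡⟨ cong₂ (λ a b → 1ℤ * 0ℤ + a + b) (dot-scaleˡ t (powers t (suc e)) c)
             (trans (dot-powers-∷ʳ0 t (map ((- ρ) *_) c)) (dot-scaleʳ (- ρ) (powers t (suc e)) c)) ⟩
      1ℤ * 0ℤ + t * dot (powers t (suc e)) c + (- ρ) * dot (powers t (suc e)) c
    ≡⟨ cong (λ v → 1ℤ * 0ℤ + t * v + (- ρ) * v) (eval-rootPoly t ρs) ⟩
      1ℤ * 0ℤ + t * v + (- ρ) * v
    ≡⟨ factor t ρ v ⟩
      (t - ρ) * v ∎
    where
    open ≡-Reasoning
    T = powers t (suc (suc e))
    c = rootPoly ρs
    v = product (map (λ s → t - s) ρs)
    factor : ∀ t ρ v → 1ℤ * 0ℤ + t * v + (- ρ) * v ≡ (t - ρ) * v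
    factor = solve-∀

module LinearAlgebra where

  open import Data.Nat as ℕ using (ℕ; zero; suc; _<_; _≤_; s≤s)
  import Data.Nat.Properties as ℕ
  open import Data.Integer using (ℤ; 0ℤ; 1ℤ; _+_; _*_; -_; _≟_)
  open import Data.Integer.Properties using (+-*-semiring; +-identityʳ; *-zeroʳ; *-identityˡ; i*j≡0⇒i≡0∨j≡0)
  open import Data.Integer.Tactic.RingSolver using (solve-∀)
  open import Data.Fin using (Fin; zero; suc; punchIn)
  open import Data.Fin.Properties using (all?; ¬∀⟶∃¬; punchInᵢ≢i) renaming (_≟_ to _≟ᶠ_)
  open import Data.Fin.Subset using (Subset; _∈_; _∉_; ∣_∣; _-_; ⁅_⁆)
  open import Data.Fin.Subset.Properties using (_∈?_; p─q⊆p)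
  open import Data.Vec using (Vec; []; _∷_; lookup)
  open import Data.Vec.Functional using (removeAt)
  open import Data.Product using (_,_)
  open import Data.Sum using (inj₁; inj₂)
  open import Data.Empty using (⊥-elim)
  open import Function using (_∘_)
  open import Relation.Binary.PropositionalEquality
    using (_≡_; _≢_; refl; sym; trans; cong; cong₂; module ≡-Reasoning)
  open import Relation.Nullary using (yes; no)
  open import Relation.Nullary.Decidable using (_→-dec_)
  open import Algebra.Properties.Semiring.Sum +-*-semiring
    using (sum; sum-cong-≗; sum-replicate-zero; sum-remove; ∑-distrib-+; ∑-comm; *-distribˡ-sum)
  open IntegerVectors using (dot)
  open SubsetFacts using (x∈p-y⇒x≢y; ∣p∣≤1+∣p-x∣; 0<∣p∣⇒Nonempty)

  sum-zero : ∀ {n} (f : Fin n → ℤ) → (∀ x → f x ≡ 0ℤ) → sum f ≡ 0ℤ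
  sum-zero {n} f f≡0 = trans (sum-cong-≗ f≡0) (sum-replicate-zero n)

  sum-single : ∀ {n} (f : Fin n → ℤ) (p : Fin n) → (∀ x → x ≢ p → f x ≡ 0ℤ) → sum f ≡ f p
  sum-single {suc n} f p f≡0 = begin
      sum f                    ≡⟨ sum-remove {i = p} f ⟩
      f p + sum (removeAt f p) ≡⟨ cong (f p +_) (sum-zero _ (λ j → f≡0 (punchIn p j) (punchInᵢ≢i p j))) ⟩
      f p + 0ℤ                 ≡⟨ +-identityʳ (f p) ⟩
      f p                      ∎
    where open ≡-Reasoning

  sum-linear : ∀ {n} (a b : ℤ) (f g : Fin n → ℤ) → sum (λ x → a * f x + b * g x) ≡ a * sum f + b * sum g
  sum-linear a b f g = trans (∑-distrib-+ (λ x → a * f x) (λ x → b * g x))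
                             (cong₂ _+_ (sym (*-distribˡ-sum a f)) (sym (*-distribˡ-sum b g)))

  dot≡sum : ∀ {n} (u v : Vec ℤ n) → dot u v ≡ sum (λ k → lookup u k * lookup v k)
  dot≡sum []       []       = refl
  dot≡sum (a ∷ as) (b ∷ bs) = cong (a * b +_) (dot≡sum as bs)

  δ : ∀ {n} → Fin n → Fin n → ℤ
  δ p x with x ≟ᶠ p
  ... | yes _ = 1ℤ
  ... | no  _ = 0ℤ

  δ-same : ∀ {n} (p : Fin n) → δ p p ≡ 1ℤ
  δ-same p with p ≟ᶠ p
  ... | yes _   = refl
  ... | no  p≢p = ⊥-elim (p≢p refl)

  δ-other : ∀ {n} (p x : Fin n) → x ≢ p → δ p x ≡ 0ℤ
  δ-other p x x≢p with x ≟ᶠ p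
  ... | yes x≡p = ⊥-elim (x≢p x≡p)
  ... | no  _   = refl

  sum-δ : ∀ {n} (p : Fin n) (w : Fin n → ℤ) → sum (λ x → δ p x * w x) ≡ w p
  sum-δ p w = trans (sum-single _ p (λ x x≢p → cong (_* w x) (δ-other p x x≢p)))
                    (trans (cong (_* w p) (δ-same p)) (*-identityˡ (w p)))

  record Dependence {N D : ℕ} (S : Subset N) (v : Fin N → Fin D → ℤ) : Set where
    field
      coeff           : Fin N → ℤ
      coeff-outside   : ∀ x → x ∉ S → coeff x ≡ 0ℤ
      witness         : Fin N
      witness∈S       : witness ∈ S
      coeff-witness≢0 : coeff witness ≢ 0ℤ
      relation        : ∀ k → sum (λ x → coeff x * v x k) ≡ 0ℤ

  prepend-zero-coordinate : ∀ {N D} (S : Subset N) (v : Fin N → Fin (suc D) → ℤ) →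
    (∀ x → x ∈ S → v x zero ≡ 0ℤ) → Dependence S (λ x k → v x (suc k)) → Dependence S v
  prepend-zero-coordinate S v first≡0 dep = record
    { coeff = coeff ; coeff-outside = coeff-outside ; witness = witness ; witness∈S = witness∈S
    ; coeff-witness≢0 = coeff-witness≢0
    ; relation = λ { zero → sum-zero _ term≡0 ; (suc k) → relation k } }
    where
    open Dependence dep
    term≡0 : ∀ x → coeff x * v x zero ≡ 0ℤ
    term≡0 x with x ∈? S
    ... | yes x∈S = trans (cong (coeff x *_) (first≡0 x x∈S)) (*-zeroʳ (coeff x))
    ... | no  x∉S = cong (_* v x zero) (coeff-outside x x∉S)

  -- One step of fraction-free Gaussian elimination with pivot p, α = v p 0 ≢ 0:
  -- the reduced vectors α · v x (k+1) − v x 0 · v p (k+1) have one coordinate fewer.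
  reduce : ∀ {N D} → (Fin N → Fin (suc D) → ℤ) → Fin N → Fin N → Fin D → ℤ
  reduce v p x k = v p zero * v x (suc k) + - (v x zero * v p (suc k))

  lift-dependence : ∀ {N D} (S : Subset N) (v : Fin N → Fin (suc D) → ℤ) (p : Fin N) →
    p ∈ S → v p zero ≢ 0ℤ → Dependence (S - p) (reduce v p) → Dependence S v
  lift-dependence {N} S v p p∈S α≢0 dep = record
    { coeff = λ x → α * μ x + (- s) * δ p x
    ; coeff-outside = outside
    ; witness = q ; witness∈S = p─q⊆p S ⁅ p ⁆ q∈S-p
    ; coeff-witness≢0 = nonzero
    ; relation = λ { zero → first ; (suc k) → rest k } }
    where
    open Dependence dep renaming
      (coeff to μ; coeff-outside to μ-outside; witness to q; witness∈S to q∈S-p; coeff-witness≢0 to μq≢0)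
    α = v p zero
    s = sum (λ x → μ x * v x zero)

    outside : ∀ x → x ∉ S → α * μ x + (- s) * δ p x ≡ 0ℤ
    outside x x∉S = trans (cong₂ (λ a b → α * a + (- s) * b) (μ-outside x (x∉S ∘ p─q⊆p S ⁅ p ⁆))
                                                           (δ-other p x (λ { refl → x∉S p∈S })))
                          (vanish α s)
      where
      vanish : ∀ a s → a * 0ℤ + (- s) * 0ℤ ≡ 0ℤ
      vanish = solve-∀

    -- q ∈ S − p differs from p, so the δ-term vanishes at q.
    coeff-at-q : α * μ q + (- s) * δ p q ≡ α * μ q
    coeff-at-q = trans (cong (λ b → α * μ q + (- s) * b) (δ-other p q (x∈p-y⇒x≢y q∈S-p))) (drop-zero α (μ q) s)
      where
      drop-zero : ∀ a m s → a * m + (- s) * 0ℤ ≡ a * m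
      drop-zero = solve-∀

    nonzero : α * μ q + (- s) * δ p q ≢ 0ℤ
    nonzero eq with i*j≡0⇒i≡0∨j≡0 α (trans (sym coeff-at-q) eq)
    ... | inj₁ α≡0  = α≢0 α≡0
    ... | inj₂ μq≡0 = μq≢0 μq≡0

    pairing : ∀ (w : Fin N → ℤ) → sum (λ x → (α * μ x + (- s) * δ p x) * w x) ≡ α * sum (λ x → μ x * w x) + (- s) * w p
    pairing w = begin
        sum (λ x → (α * μ x + (- s) * δ p x) * w x)
      ≡⟨ sum-cong-≗ (λ x → expand α (μ x) s (δ p x) (w x)) ⟩
        sum (λ x → α * (μ x * w x) + (- s) * (δ p x * w x))
      ≡⟨ sum-linear α (- s) (λ x → μ x * w x) (λ x → δ p x * w x) ⟩
        α * sum (λ x → μ x * w x) + (- s) * sum (λ x → δ p x * w x)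
      ≡⟨ cong (λ z → α * sum (λ x → μ x * w x) + (- s) * z) (sum-δ p w) ⟩
        α * sum (λ x → μ x * w x) + (- s) * w p ∎
      where
      open ≡-Reasoning
      expand : ∀ a m s d w → (a * m + (- s) * d) * w ≡ a * (m * w) + (- s) * (d * w)
      expand = solve-∀

    first : sum (λ x → (α * μ x + (- s) * δ p x) * v x zero) ≡ 0ℤ
    first = trans (pairing (λ x → v x zero)) (cancel α s)
      where
      cancel : ∀ a s → a * s + (- s) * a ≡ 0ℤ
      cancel = solve-∀

    rest : ∀ k → sum (λ x → (α * μ x + (- s) * δ p x) * v x (suc k)) ≡ 0ℤ
    rest k = begin
        sum (λ x → (α * μ x + (- s) * δ p x) * v x (suc k))
      ≡⟨ pairing (λ x → v x (suc k)) ⟩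
        α * T + (- s) * t
      ≡⟨ cong (α * T +_) (swap s t) ⟩
        α * T + (- t) * s
      ≡⟨ sym (sum-linear α (- t) (λ x → μ x * v x (suc k)) (λ x → μ x * v x zero)) ⟩
        sum (λ x → α * (μ x * v x (suc k)) + (- t) * (μ x * v x zero))
      ≡⟨ sum-cong-≗ (λ x → regroup α (μ x) (v x (suc k)) t (v x zero)) ⟩
        sum (λ x → μ x * reduce v p x k)
      ≡⟨ relation k ⟩
        0ℤ ∎
      where
      open ≡-Reasoning
      T = sum (λ x → μ x * v x (suc k))
      t = v p (suc k)
      swap : ∀ s t → (- s) * t ≡ (- t) * s
      swap = solve-∀
      regroup : ∀ a m y t h → a * (m * y) + (- t) * (m * h) ≡ m * (a * y + - (h * t))
      regroup = solve-∀

  -- More than D vectors in ℤᴰ are linearly dependent over ℤ.  By induction on D: a first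
  -- coordinate vanishing on S is dropped, otherwise it is eliminated with a pivot p ∈ S.
  dependence : ∀ D {N} (S : Subset N) (v : Fin N → Fin D → ℤ) → D < ∣ S ∣ → Dependence S v
  dependence zero S v 0<∣S∣ with 0<∣p∣⇒Nonempty S 0<∣S∣
  ... | x , x∈S = record
    { coeff = δ x ; coeff-outside = λ y y∉S → δ-other x y (λ { refl → y∉S x∈S })
    ; witness = x ; witness∈S = x∈S ; coeff-witness≢0 = λ δxx≡0 → 1≢0 (trans (sym (δ-same x)) δxx≡0)
    ; relation = λ () }
    where
    1≢0 : 1ℤ ≢ 0ℤ
    1≢0 ()
  dependence (suc D) S v D<∣S∣ with all? (λ x → x ∈? S →-dec v x zero ≟ 0ℤ)
  ... | yes first≡0 =
    prepend-zero-coordinate S v first≡0 (dependence D S (λ x k → v x (suc k)) (ℕ.<-trans (ℕ.n<1+n D) D<∣S∣))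
  ... | no ¬first≡0 with ¬∀⟶∃¬ _ _ (λ x → x ∈? S →-dec v x zero ≟ 0ℤ) ¬first≡0
  ... | p , ¬[p∈S⇒vp≡0] with p ∈? S
  ...   | no  p∉S = ⊥-elim (¬[p∈S⇒vp≡0] (λ p∈S → ⊥-elim (p∉S p∈S)))
  ...   | yes p∈S = lift-dependence S v p p∈S (λ vp≡0 → ¬[p∈S⇒vp≡0] (λ _ → vp≡0))
                      (dependence D (S - p) (reduce v p) (ℕ.≤-pred (ℕ.≤-trans D<∣S∣ (∣p∣≤1+∣p-x∣ S p))))

  triangular : ∀ {N} (S : Subset N) (r : Fin N → ℕ) (M : Fin N → Fin N → ℤ) (c : Fin N → ℤ) →
    (∀ x → x ∉ S → c x ≡ 0ℤ) →
    (∀ z → z ∈ S → M z z ≢ 0ℤ) →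
    (∀ z y → z ∈ S → y ∈ S → y ≢ z → r z ≤ r y → M z y ≡ 0ℤ) →
    (∀ z → sum (λ y → c y * M z y) ≡ 0ℤ) →
    ∀ z → z ∈ S → c z ≡ 0ℤ
  triangular {N} S r M c outside diagonal upper relation z z∈S = below (suc (r z)) z z∈S ℕ.≤-refl
    where
    below : ∀ n z → z ∈ S → r z < n → c z ≡ 0ℤ
    below (suc n) z z∈S (s≤s rz≤n) with i*j≡0⇒i≡0∨j≡0 (c z) diagonal-term≡0
      where
      other-term≡0 : ∀ y → y ≢ z → c y * M z y ≡ 0ℤ
      other-term≡0 y y≢z with y ∈? S
      ... | no  y∉S = cong (_* M z y) (outside y y∉S)
      ... | yes y∈S with r z ℕ.≤? r y
      ...   | yes rz≤ry = trans (cong (c y *_) (upper z y z∈S y∈S y≢z rz≤ry)) (*-zeroʳ (c y))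
      ...   | no  rz≰ry = cong (_* M z y) (below n y y∈S (ℕ.<-≤-trans (ℕ.≰⇒> rz≰ry) rz≤n))
      diagonal-term≡0 : c z * M z z ≡ 0ℤ
      diagonal-term≡0 = trans (sym (sum-single (λ y → c y * M z y) z other-term≡0)) (relation z)
    ... | inj₁ cz≡0 = cz≡0
    ... | inj₂ Mzz≡0 = ⊥-elim (diagonal z z∈S Mzz≡0)

  pair-relation : ∀ {N D} (c : Fin N → ℤ) (p : Fin N → Vec ℤ D) →
    (∀ k → sum (λ y → c y * lookup (p y) k) ≡ 0ℤ) → ∀ w → sum (λ y → c y * dot (p y) w) ≡ 0ℤ
  pair-relation {N} {D} c p relation w = begin
      sum (λ y → c y * dot (p y) w)
    ≡⟨ sum-cong-≗ (λ y → trans (cong (c y *_) (dot≡sum (p y) w)) (*-distribˡ-sum (c y) (λ k → lookup (p y) k * lookup w k))) ⟩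
      sum (λ y → sum (λ k → c y * (lookup (p y) k * lookup w k)))
    ≡⟨ ∑-comm (λ y k → c y * (lookup (p y) k * lookup w k)) ⟩
      sum (λ k → sum (λ y → c y * (lookup (p y) k * lookup w k)))
    ≡⟨ sum-zero _ coordinate≡0 ⟩
      0ℤ ∎
    where
    open ≡-Reasoning
    coordinate≡0 : ∀ k → sum (λ y → c y * (lookup (p y) k * lookup w k)) ≡ 0ℤ
    coordinate≡0 k = begin
        sum (λ y → c y * (lookup (p y) k * lookup w k))
      ≡⟨ sum-cong-≗ (λ y → reorder (c y) (lookup (p y) k) (lookup w k)) ⟩
        sum (λ y → lookup w k * (c y * lookup (p y) k))
      ≡⟨ sym (*-distribˡ-sum (lookup w k) (λ y → c y * lookup (p y) k)) ⟩
        lookup w k * sum (λ y → c y * lookup (p y) k)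
      ≡⟨ cong (lookup w k *_) (relation k) ⟩
        lookup w k * 0ℤ
      ≡⟨ *-zeroʳ (lookup w k) ⟩
        0ℤ ∎
      where
      reorder : ∀ l a b → l * (a * b) ≡ b * (l * a)
      reorder = solve-∀

  rank-bound : ∀ D {N} (S : Subset N) (r : Fin N → ℕ) (p w : Fin N → Vec ℤ D) →
    (∀ z → z ∈ S → dot (p z) (w z) ≢ 0ℤ) →
    (∀ z y → z ∈ S → y ∈ S → y ≢ z → r z ≤ r y → dot (p y) (w z) ≡ 0ℤ) →
    ∣ S ∣ ≤ D
  rank-bound D S r p w diagonal upper with D ℕ.<? ∣ S ∣
  ... | no  D≮∣S∣ = ℕ.≮⇒≥ D≮∣S∣
  ... | yes D<∣S∣ = ⊥-elim (coeff-witness≢0 (coeff-vanishes-on-S witness witness∈S))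
    where
    open Dependence (dependence D S (λ x k → lookup (p x) k) D<∣S∣)
    -- Triangularity forces any dependence among the p y to be trivial.
    coeff-vanishes-on-S : ∀ z → z ∈ S → coeff z ≡ 0ℤ
    coeff-vanishes-on-S = triangular S r (λ z y → dot (p y) (w z)) coeff coeff-outside diagonal upper
                                     (pair-relation coeff p relation ∘ w)

module SkewBollobas where

  open import Data.Nat as ℕ using (ℕ; zero; suc; _+_; _≤_; s≤s)
  import Data.Nat.Properties as ℕ
  open import Data.Nat.Combinatorics using (_C_; nCn≡1; nCk+nC[k+1]≡[n+1]C[k+1])
  open import Data.Integer using (ℤ; +_; -[1+_]; 0ℤ; _-_)
  open import Data.Integer.Properties using (+-inverseʳ; +-injective; i-j≡0⇒i≡j)
  open import Data.Fin using (Fin; zero; suc; toℕ)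
  open import Data.Fin.Properties using (toℕ-injective)
  open import Data.Fin.Subset using (Subset; _∈_; _∩_; ∣_∣; inside; outside; Empty; Nonempty)
  open import Data.Fin.Subset.Properties using (x∈p∩q⁺; x∈p∩q⁻)
  open import Data.Vec using (Vec; []; _∷_; map; replicate)
  open import Data.Vec.Base using (here; there)
  open import Data.Vec.Properties using (map-∘; map-cong)
  open import Data.Vec.Relation.Unary.Any using (here; there)
  open import Data.Vec.Relation.Unary.Any.Properties using () renaming (map⁺ to any-map⁺)
  open import Data.Vec.Relation.Unary.All as All using (All; []; _∷_)
  open import Data.Vec.Relation.Unary.All.Properties using () renaming (map⁺ to all-map⁺)
  open import Data.Vec.Membership.Propositional using (lose) renaming (_∈_ to _∈ᵥ_)
  open import Data.Vec.Membership.Propositional.Properties using (∈-map⁺)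
  open import Data.Product using (_,_)
  open import Function using (_∘_)
  open import Relation.Binary.PropositionalEquality
    using (_≡_; _≢_; refl; sym; trans; cong; cong₂; subst; module ≡-Reasoning)
  open IntegerVectors
  open Polynomials
  open LinearAlgebra using (rank-bound)

  dim-binomial : ∀ d e → dim d (suc e) ≡ (d + e) C e
  dim-binomial zero    e       = sym (nCn≡1 e)
  dim-binomial (suc d) zero    = trans (ℕ.+-identityʳ (dim d 1)) (dim-binomial d zero)
  dim-binomial (suc d) (suc e) = begin
      dim d (suc (suc e)) + dim (suc d) (suc e)
    ≡⟨ cong₂ _+_ (dim-binomial d (suc e)) (dim-binomial (suc d) e) ⟩
      (d + suc e) C suc e + (suc d + e) C e
    ≡⟨ cong (λ n → (d + suc e) C suc e + n C e) (sym (ℕ.+-suc d e)) ⟩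
      (d + suc e) C suc e + (d + suc e) C e
    ≡⟨ ℕ.+-comm ((d + suc e) C suc e) _ ⟩
      (d + suc e) C e + (d + suc e) C suc e
    ≡⟨ nCk+nC[k+1]≡[n+1]C[k+1] (d + suc e) e ⟩
      suc (d + suc e) C suc e ∎
    where open ≡-Reasoning

  resultant : ∀ {d e} → Vec ℤ d → Vec ℤ e → ℤ
  resultant ts ss = product (map (λ t → product (map (λ s → t - s) ss)) ts)

  resultant-zero : ∀ {d e} {ts : Vec ℤ d} {ss : Vec ℤ e} {t} → t ∈ᵥ ts → t ∈ᵥ ss → resultant ts ss ≡ 0ℤ
  resultant-zero {t = t} t∈ts t∈ss =
    product-zero (any-map⁺ (lose t∈ts (product-zero (any-map⁺ (lose t∈ss (+-inverseʳ t))))))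

  resultant-nonzero : ∀ {d e} {ts : Vec ℤ d} {ss : Vec ℤ e} → All (λ t → All (t ≢_) ss) ts → resultant ts ss ≢ 0ℤ
  resultant-nonzero {ss = ss} distinct = product-nonzero (all-map⁺ (All.map row-nonzero distinct))
    where
    row-nonzero : ∀ {t} → All (t ≢_) ss → product (map (λ s → t - s) ss) ≢ 0ℤ
    row-nonzero t≢ss = product-nonzero (all-map⁺ (All.map (λ t≢s → t≢s ∘ i-j≡0⇒i≡j _ _) t≢ss))

  eval-resultant : ∀ {d e} (ts : Vec ℤ d) (ss : Vec ℤ e) →
    eval d (productOfLinear (map (λ t → powers t (suc e)) ts)) (rootPoly ss) ≡ resultant ts ss
  eval-resultant {e = e} ts ss = trans (eval-productOfLinear (map (λ t → powers t (suc e)) ts) (rootPoly ss))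
    (cong product (trans (sym (map-∘ (λ L → dot L (rootPoly ss)) (λ t → powers t (suc e)) ts))
                         (map-cong (λ t → eval-rootPoly t ss) ts)))

  elements : ∀ {N} (T : Subset N) → Vec (Fin N) ∣ T ∣
  elements []            = []
  elements (inside  ∷ T) = zero ∷ map suc (elements T)
  elements (outside ∷ T) = map suc (elements T)

  elements-complete : ∀ {N} (T : Subset N) {f} → f ∈ T → f ∈ᵥ elements T
  elements-complete (inside  ∷ T) {zero}  here        = here refl
  elements-complete (inside  ∷ T) {suc f} (there f∈T) = there (∈-map⁺ suc (elements-complete T f∈T))
  elements-complete (outside ∷ T) {suc f} (there f∈T) = ∈-map⁺ suc (elements-complete T f∈T)

  elements-sound : ∀ {N} (T : Subset N) → All (_∈ T) (elements T)
  elements-sound []            = []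
  elements-sound (inside  ∷ T) = here ∷ all-map⁺ (All.map there (elements-sound T))
  elements-sound (outside ∷ T) = all-map⁺ (All.map there (elements-sound T))

  fit : ∀ {A : Set} {k} → Vec A k → (d : ℕ) → A → Vec A d
  fit []       d       c = replicate d c
  fit (x ∷ xs) zero    c = []
  fit (x ∷ xs) (suc d) c = x ∷ fit xs d c

  fit-complete : ∀ {A : Set} {k} (xs : Vec A k) d (c : A) → k ≤ d → ∀ {x} → x ∈ᵥ xs → x ∈ᵥ fit xs d c
  fit-complete (x ∷ xs) (suc d) c (s≤s k≤d) (here x≡)   = here x≡
  fit-complete (x ∷ xs) (suc d) c (s≤s k≤d) (there x∈) = there (fit-complete xs d c k≤d x∈)

  fit-all : ∀ {A : Set} {Q : A → Set} {k} {xs : Vec A k} d {c : A} → All Q xs → Q c → All Q (fit xs d c)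
  fit-all {xs = []}     zero    []         qc = []
  fit-all {xs = []}     (suc d) []         qc = qc ∷ fit-all d [] qc
  fit-all {xs = x ∷ xs} zero    _          qc = []
  fit-all {xs = x ∷ xs} (suc d) (qx ∷ qxs) qc = qx ∷ fit-all d qxs qc

  -- Points of Fin N are encoded by nonnegative integers; padding entries will be negative.
  encode : ∀ {N} → Fin N → ℤ
  encode f = + toℕ f

  codes : ∀ {N} → Subset N → (d : ℕ) → ℤ → Vec ℤ d
  codes T d c = fit (map encode (elements T)) d c

  codes-complete : ∀ {N} (T : Subset N) {d c} → ∣ T ∣ ≤ d → ∀ {f} → f ∈ T → encode f ∈ᵥ codes T d c
  codes-complete T {d} {c} ∣T∣≤d f∈T = fit-complete _ d c ∣T∣≤d (∈-map⁺ encode (elements-complete T f∈T))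

  codes-all : ∀ {N} (T : Subset N) d {c} (Q : ℤ → Set) → (∀ {f} → f ∈ T → Q (encode f)) → Q c → All Q (codes T d c)
  codes-all T d Q q qc = fit-all d (all-map⁺ (All.map q (elements-sound T))) qc

  record SkewSystem (d e N : ℕ) : Set where
    field
      S        : Subset N
      r        : Fin N → ℕ
      P R      : Fin N → Subset N
      size-P   : ∀ x → x ∈ S → ∣ P x ∣ ≤ d
      size-R   : ∀ x → x ∈ S → ∣ R x ∣ ≤ e
      disjoint : ∀ x → x ∈ S → Empty (P x ∩ R x)
      cross    : ∀ z y → z ∈ S → y ∈ S → y ≢ z → r z ≤ r y → Nonempty (P y ∩ R z)

  -- The polynomial of y
  -- is ∏_{t ∈ P y} (Σᵢ tⁱ uᵢ), the point of z the coefficient vector of ∏_{s ∈ R z} (X − s);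
  -- the value of the one at the other is the resultant of (the codes of) P y and R z, nonzero
  -- for y = z by disjointness and zero under the cross condition, so rank-bound applies in
  -- the space of degree-d forms in e + 1 variables.
  skew-bollobas : ∀ {d e N} (sys : SkewSystem d e N) → ∣ SkewSystem.S sys ∣ ≤ (d + e) C e
  skew-bollobas {d} {e} {N} sys = subst (∣ S ∣ ≤_) (dim-binomial d e)
    (rank-bound (dim d (suc e)) S r polynomial (λ z → monomials d (point z)) diagonal upper)
    where
    open SkewSystem sys

    -- Distinct negative paddings, so that padding never creates a common entry.
    padP padR : ℤ
    padP = -[1+ 0 ]
    padR = -[1+ 1 ]

    polynomial : Fin N → Poly d (suc e)
    polynomial y = productOfLinear (map (λ t → powers t (suc e)) (codes (P y) d padP))

    point : Fin N → Vec ℤ (suc e)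
    point z = rootPoly (codes (R z) e padR)

    value : ∀ y z → dot (polynomial y) (monomials d (point z)) ≡ resultant (codes (P y) d padP) (codes (R z) e padR)
    value y z = eval-resultant (codes (P y) d padP) (codes (R z) e padR)

    diagonal : ∀ z → z ∈ S → dot (polynomial z) (monomials d (point z)) ≢ 0ℤ
    diagonal z z∈S = resultant-nonzero distinct ∘ trans (sym (value z z))
      where
      encode-separated : ∀ {f} → f ∈ P z → All (encode f ≢_) (codes (R z) e padR)
      encode-separated f∈P = codes-all (R z) e _
        (λ g∈R f≡g → disjoint z z∈S (_ , x∈p∩q⁺ (f∈P , subst (_∈ R z) (sym (toℕ-injective (+-injective f≡g))) g∈R)))
        (λ ())
      distinct : All (λ t → All (t ≢_) (codes (R z) e padR)) (codes (P z) d padP)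
      distinct = codes-all (P z) d _ encode-separated (codes-all (R z) e _ (λ _ ()) (λ ()))

    upper : ∀ z y → z ∈ S → y ∈ S → y ≢ z → r z ≤ r y → dot (polynomial y) (monomials d (point z)) ≡ 0ℤ
    upper z y z∈S y∈S y≢z rz≤ry with cross z y z∈S y∈S y≢z rz≤ry
    ... | f , f∈Py∩Rz with x∈p∩q⁻ (P y) (R z) f∈Py∩Rz
    ...   | f∈Py , f∈Rz = trans (value y z) (resultant-zero (codes-complete (P y) (size-P y y∈S) f∈Py)
                                                          (codes-complete (R z) (size-R z z∈S) f∈Rz))

module FirstOccurrence where

  open import Data.Nat using (zero; suc; _≤_; z≤n; s≤s)
  import Data.Nat.Properties as ℕ
  open import Data.Fin using (Fin; zero; suc; toℕ)
  open import Data.Fin.Properties using (toℕ-injective) renaming (_≟_ to _≟ᶠ_)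
  open import Data.Fin.Subset
  open import Data.Fin.Subset.Properties
  open import Data.List using (List; []; _∷_; map; allFin)
  open import Data.Product using (_,_; ∃)
  open import Data.Sum using (_⊎_; inj₁; inj₂)
  open import Data.Empty using (⊥-elim)
  open import Function using (_∘_)
  open import Relation.Binary.PropositionalEquality using (_≢_; refl; sym; subst)
  open import Relation.Nullary using (Dec; yes; no)
  open import Defs
  open SubsetFacts
  open SkewBollobas using (SkewSystem)

  -- The least index satisfying a decidable predicate (zero if there is none).
  leastIndex : ∀ {m} {Q : Fin (suc m) → Set} → (∀ i → Dec (Q i)) → Fin (suc m)
  leastIndex {zero}  Q? = zero
  leastIndex {suc m} Q? with Q? zero
  ... | yes _ = zero
  ... | no  _ = suc (leastIndex (Q? ∘ suc))

  leastIndex-sound : ∀ {m} {Q : Fin (suc m) → Set} (Q? : ∀ i → Dec (Q i)) {j} → Q j → Q (leastIndex Q?)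
  leastIndex-sound {zero}  Q? {zero}  q = q
  leastIndex-sound {suc m} Q? {j}     q with Q? zero
  leastIndex-sound {suc m} Q? {j}     q | yes q₀ = q₀
  leastIndex-sound {suc m} Q? {zero}  q | no ¬q₀ = ⊥-elim (¬q₀ q)
  leastIndex-sound {suc m} Q? {suc j} q | no ¬q₀ = leastIndex-sound (Q? ∘ suc) q

  leastIndex-least : ∀ {m} {Q : Fin (suc m) → Set} (Q? : ∀ i → Dec (Q i)) {j} → Q j → toℕ (leastIndex Q?) ≤ toℕ j
  leastIndex-least {zero}  Q? {zero}  q = z≤n
  leastIndex-least {suc m} Q? {j}     q with Q? zero
  leastIndex-least {suc m} Q? {j}     q | yes _  = z≤n
  leastIndex-least {suc m} Q? {zero}  q | no ¬q₀ = ⊥-elim (¬q₀ q)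
  leastIndex-least {suc m} Q? {suc j} q | no ¬q₀ = s≤s (leastIndex-least (Q? ∘ suc) q)

  x∈⋃⁻ : ∀ {N m} (f : Fin m → Subset N) (is : List (Fin m)) {x} → x ∈ ⋃ (map f is) → ∃ λ i → x ∈ f i
  x∈⋃⁻ f []       x∈⊥ = ⊥-elim (∉⊥ x∈⊥)
  x∈⋃⁻ f (i ∷ is) {x} x∈ with x∈p∪q⁻ (f i) (⋃ (map f is)) x∈
  ... | inj₁ x∈fi = i , x∈fi
  ... | inj₂ x∈⋃  = x∈⋃⁻ f is x∈⋃

  firstIndex : ∀ {N m} (A B : Fin (suc m) → Subset N) → Fin N → Fin (suc m)
  firstIndex A B x = leastIndex (λ i → x ∈? A i ∪ B i)

  firstIndex-least : ∀ {N m} (A B : Fin (suc m) → Subset N) x i → x ∈ A i ⊎ x ∈ B i → toℕ (firstIndex A B x) ≤ toℕ i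
  firstIndex-least A B x i x∈ = leastIndex-least (λ i → x ∈? A i ∪ B i) (x∈p∪q⁺ x∈)

  firstInA : ∀ {N m} (A : Fin (suc m) → Subset N) (ι : Fin N → Fin (suc m)) → Subset N
  firstInA A ι = select (λ x → x ∈? A (ι x))

  unionAll-covered : ∀ {N m} (A B : Fin (suc m) → Subset N) →
    unionAll A B ⊆ firstInA A (firstIndex A B) ∪ firstInA B (firstIndex A B)
  unionAll-covered {m = m} A B {x} x∈U with x∈⋃⁻ (λ i → A i ∪ B i) (allFin (suc m)) x∈U
  ... | i , x∈ABi with x∈p∪q⁻ (A (firstIndex A B x)) (B (firstIndex A B x)) (leastIndex-sound (λ i → x ∈? A i ∪ B i) x∈ABi)
  ...   | inj₁ x∈A = x∈p∪q⁺ (inj₁ (select⁺ (λ y → y ∈? A (firstIndex A B y)) x∈A))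
  ...   | inj₂ x∈B = x∈p∪q⁺ (inj₂ (select⁺ (λ y → y ∈? B (firstIndex A B y)) x∈B))

  swapped : ∀ {k l N m} {A B : Fin m → Subset N} → CrossIntersecting k l N m A B → CrossIntersecting l k N m B A
  swapped {A = A} {B} ci = record
    { sizeA    = sizeB
    ; sizeB    = sizeA
    ; disjoint = λ i → subst Empty (∩-comm (A i) (B i)) (disjoint i)
    ; cross    = λ i j i≢j → subst Nonempty (∩-comm (A j) (B i)) (cross j i (i≢j ∘ sym)) }
    where open CrossIntersecting ci

  -- Rank each point x by its first pair ι x.  For the points x in
  -- A (ι x), the pairs (A (ι x) − x , ⁅x⁆ ∪ B (ι x)) form a skew system: if ι z = ι y the
  -- point z itself is common, otherwise A (ι y) ∩ B (ι z) has a point, and it is not y,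
  -- because y ∈ B (ι z) would force ι y ≤ ι z.
  firstOccurrenceSystem : ∀ {k l N m} {A B : Fin (suc m) → Subset N} → CrossIntersecting (suc k) l N (suc m) A B →
    (ι : Fin N → Fin (suc m)) → (∀ x i → x ∈ A i ⊎ x ∈ B i → toℕ (ι x) ≤ toℕ i) → SkewSystem k (suc l) N
  firstOccurrenceSystem {k} {l} {N} {m} {A} {B} ci ι ι-least = record
    { S = firstInA A ι ; r = toℕ ∘ ι ; P = P ; R = R
    ; size-P = size-P ; size-R = size-R ; disjoint = disjoint′ ; cross = cross′ }
    where
    open CrossIntersecting ci
    P R : Fin N → Subset N
    P x = A (ι x) - x
    R x = ⁅ x ⁆ ∪ B (ι x)

    x∈A : ∀ {x} → x ∈ firstInA A ι → x ∈ A (ι x)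
    x∈A = select⁻ (λ x → x ∈? A (ι x))

    size-P : ∀ x → x ∈ firstInA A ι → ∣ P x ∣ ≤ k
    size-P x x∈S = ℕ.≤-pred (ℕ.≤-trans (x∈p⇒∣p-x∣<∣p∣ (x∈A x∈S)) (sizeA (ι x)))

    size-R : ∀ x → x ∈ firstInA A ι → ∣ R x ∣ ≤ suc l
    size-R x _ = ℕ.≤-trans (∣⁅x⁆∪p∣≤1+∣p∣ x (B (ι x))) (s≤s (sizeB (ι x)))

    disjoint′ : ∀ x → x ∈ firstInA A ι → Empty (P x ∩ R x)
    disjoint′ x _ (f , f∈P∩R) with x∈p∩q⁻ (P x) (R x) f∈P∩R
    ... | f∈P , f∈R with x∈p∪q⁻ ⁅ x ⁆ (B (ι x)) f∈R
    ...   | inj₁ f∈⁅x⁆ = x∈p-y⇒x≢y f∈P (x∈⁅y⁆⇒x≡y x f∈⁅x⁆)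
    ...   | inj₂ f∈B   = disjoint (ι x) (f , x∈p∩q⁺ (p─q⊆p (A (ι x)) ⁅ x ⁆ f∈P , f∈B))

    cross′ : ∀ z y → z ∈ firstInA A ι → y ∈ firstInA A ι → y ≢ z → toℕ (ι z) ≤ toℕ (ι y) → Nonempty (P y ∩ R z)
    cross′ z y z∈S y∈S y≢z ιz≤ιy with ι z ≟ᶠ ι y
    ... | yes ιz≡ιy = z , x∈p∩q⁺ (z∈Py , x∈p∪q⁺ (inj₁ (x∈⁅x⁆ z)))
      where
      z∈Py : z ∈ P y
      z∈Py = x∈p∧x≢y⇒x∈p-y (subst (λ i → z ∈ A i) ιz≡ιy (x∈A z∈S)) (y≢z ∘ sym)
    ... | no  ιz≢ιy with cross (ι y) (ι z) (ιz≢ιy ∘ sym)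
    ...   | w , w∈A∩B with x∈p∩q⁻ (A (ι y)) (B (ι z)) w∈A∩B
    ...     | w∈A , w∈B = w , x∈p∩q⁺ (x∈p∧x≢y⇒x∈p-y w∈A w≢y , x∈p∪q⁺ (inj₂ w∈B))
      where
      w≢y : w ≢ y
      w≢y refl = ιz≢ιy (toℕ-injective (ℕ.≤-antisym ιz≤ιy (ι-least w (ι z) (inj₂ w∈B))))

open import Defs
open import Data.Nat using (ℕ; _≤_; _+_; suc)
open import Data.Nat.Combinatorics using (_C_)
open import Data.Fin using (Fin)
open import Data.Fin.Subset using (Subset; ∣_∣)
open import Data.Nat using (zero; z≤n; s≤s)
open import Data.Nat.Properties using (+-mono-≤; +-suc; +-comm; module ≤-Reasoning)
open import Data.Fin.Subset using (_∪_)
open import Data.Fin.Subset.Properties using (p⊆q⇒∣p∣≤∣q∣; ∣⊥∣≡0)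
open import Data.Sum using (swap)
open import Function using (_∘_)
open import Relation.Binary.PropositionalEquality using (sym; trans; cong₂; subst)
open SubsetFacts using (∣p∪q∣≤∣p∣+∣q∣)
open SkewBollobas using (skew-bollobas)
open FirstOccurrence

mainTheorem6 : (k l : ℕ) → 1 ≤ k → 1 ≤ l →
    (N m : ℕ) (A B : Fin m → Subset N) → CrossIntersecting k l N m A B →
    ∣ unionAll A B ∣ ≤ ((k + l) C suc l) + ((k + l) C suc k)
mainTheorem6 k l _ _ N zero A B ci = subst (_≤ _) (sym (∣⊥∣≡0 N)) z≤n
mainTheorem6 (suc k′) (suc l′) (s≤s z≤n) (s≤s z≤n) N (suc m) A B ci = begin
    ∣ unionAll A B ∣
  ≤⟨ p⊆q⇒∣p∣≤∣q∣ (unionAll-covered A B) ⟩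
    ∣ firstInA A ι ∪ firstInA B ι ∣
  ≤⟨ ∣p∪q∣≤∣p∣+∣q∣ (firstInA A ι) (firstInA B ι) ⟩
    ∣ firstInA A ι ∣ + ∣ firstInA B ι ∣
  ≤⟨ +-mono-≤ (skew-bollobas (firstOccurrenceSystem ci ι ι-least))
              (skew-bollobas (firstOccurrenceSystem (swapped ci) ι (λ x i → ι-least x i ∘ swap))) ⟩
    (k′ + suc l) C suc l + (l′ + suc k) C suc k
  ≡⟨ cong₂ (λ a b → a C suc l + b C suc k) (+-suc k′ l) (trans (+-suc l′ k) (+-comm l k)) ⟩
    (k + l) C suc l + (k + l) C suc k ∎
  where
  open ≤-Reasoning
  k = suc k′
  l = suc l′
  ι = firstIndex A B
  ι-least = firstIndex-least A B
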